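{- If $G$ is a spider with at least three good legs, then $\gamma_{r2}(G)+\gamma_R(G)\leq \frac{4}{3}n(G)$.
   Context: A spider is a graph obtained from a star of order at least $4$ by iteratively subdividing its edges arbitrarily often (each edge may be subdivided any number of times, including zero). The center of a spider is its unique vertex of degree at least $3$; the legs of a spider are the maximal paths starting at its center; a leg is good if its length (number of edges) is not a multiple of $3$. A $2$-rainbow dominating function of a graph $G$ is a function $f:V(G)\to 2^{\{1,2\}}$ such that $\bigcup_{v\in N_G(u)}f(v)=\{1,2\}$ for every vertex $u$ with $f(u)=\emptyset$; its weight is $\sum_{u}|f(u)|$, and $\gamma_{r2}(G)$ is the minimum weight of such a function. A Roman dominating function of $G$ is a function $g:V(G)\to\{0,1,2\}$ such that every vertex $u$ with $g(u)=0$ has a neighbor $v$ with $g(v)=2$; its weight is $\sum_u g(u)$, and $\gamma_R(G)$ is the minimum weight of such a function. $n(G)$ is the order of $G$. -}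

module Defs where

open import Data.Nat using (ℕ; zero; suc; _+_; _*_; _≤_; _%_)
open import Data.Fin using (Fin; zero; suc; toℕ)
open import Data.Bool using (Bool; true; false; if_then_else_)
open import Data.Product using (Σ; ∃; _×_; _,_)
open import Relation.Binary.PropositionalEquality using (_≡_; _≢_)
open import Relation.Nullary using (¬_)

sumFin : (n : ℕ) → (Fin n → ℕ) → ℕ
sumFin zero    f = 0
sumFin (suc n) f = f zero + sumFin n (λ i → f (suc i))

countFin : (n : ℕ) → (Fin n → Bool) → ℕ
countFin n p = sumFin n (λ i → if p i then 1 else 0)

-- A spider with k legs of lengths ℓ 0, …, ℓ (k-1) (each ≥ 1,
-- k ≥ 3) is the graph with vertices: the center, and (leg i j) for
-- j : Fin (ℓ i), the vertex at distance (j+1) from the center on leg i.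
-- Every spider is isomorphic to exactly one such graph (up to ordering
-- of legs), and all quantities below are isomorphism invariant.

data SpiderV (k : ℕ) (ℓ : Fin k → ℕ) : Set where
  center : SpiderV k ℓ
  leg    : (i : Fin k) → Fin (ℓ i) → SpiderV k ℓ

data Edge {k : ℕ} {ℓ : Fin k → ℕ} : SpiderV k ℓ → SpiderV k ℓ → Set where
  c-edge : (i : Fin k) (p : Fin (ℓ i)) → toℕ p ≡ 0 → Edge center (leg i p)
  l-edge : (i : Fin k) (p q : Fin (ℓ i)) → suc (toℕ p) ≡ toℕ q →
           Edge (leg i p) (leg i q)

Adj : {k : ℕ} {ℓ : Fin k → ℕ} → SpiderV k ℓ → SpiderV k ℓ → Set
Adj u v = Edge u v Data.Sum.⊎ Edge v u
  where import Data.Sum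

order : (k : ℕ) (ℓ : Fin k → ℕ) → ℕ
order k ℓ = 1 + sumFin k ℓ

sumV : (k : ℕ) (ℓ : Fin k → ℕ) → (SpiderV k ℓ → ℕ) → ℕ
sumV k ℓ w = w center + sumFin k (λ i → sumFin (ℓ i) (λ j → w (leg i j)))

isGood : ℕ → Bool
isGood m with m % 3
... | zero = false
... | suc _ = true

-- 2-rainbow dominating functions.  A subset of {1,2} is a pair of
-- booleans (1 ∈ S , 2 ∈ S).

Sub12 : Set
Sub12 = Bool × Bool

has1 has2 : Sub12 → Bool
has1 (a , _) = a
has2 (_ , b) = b

isEmpty : Sub12 → Set
isEmpty s = (has1 s ≡ false) × (has2 s ≡ false)

card : Sub12 → ℕ
card (a , b) = (if a then 1 else 0) + (if b then 1 else 0)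

Is2RDF : (k : ℕ) (ℓ : Fin k → ℕ) → (SpiderV k ℓ → Sub12) → Set
Is2RDF k ℓ f = ∀ u → isEmpty (f u) →
  (Σ (SpiderV k ℓ) λ v → Adj u v × has1 (f v) ≡ true) ×
  (Σ (SpiderV k ℓ) λ v → Adj u v × has2 (f v) ≡ true)

weight2R : (k : ℕ) (ℓ : Fin k → ℕ) → (SpiderV k ℓ → Sub12) → ℕ
weight2R k ℓ f = sumV k ℓ (λ u → card (f u))

IsRDF : (k : ℕ) (ℓ : Fin k → ℕ) → (SpiderV k ℓ → Fin 3) → Set
IsRDF k ℓ g = ∀ u → toℕ (g u) ≡ 0 →
  Σ (SpiderV k ℓ) λ v → Adj u v × toℕ (g v) ≡ 2

weightR : (k : ℕ) (ℓ : Fin k → ℕ) → (SpiderV k ℓ → Fin 3) → ℕ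
weightR k ℓ g = sumV k ℓ (λ u → toℕ (g u))

IsGammaR2 : (k : ℕ) (ℓ : Fin k → ℕ) → ℕ → Set
IsGammaR2 k ℓ m =
  (Σ (SpiderV k ℓ → Sub12) λ f → Is2RDF k ℓ f × weight2R k ℓ f ≡ m) ×
  (∀ f → Is2RDF k ℓ f → m ≤ weight2R k ℓ f)

IsGammaR : (k : ℕ) (ℓ : Fin k → ℕ) → ℕ → Set
IsGammaR k ℓ m =
  (Σ (SpiderV k ℓ → Fin 3) λ g → IsRDF k ℓ g × weightR k ℓ g ≡ m) ×
  (∀ g → IsRDF k ℓ g → m ≤ weightR k ℓ g)

module Submission where

-- We exhibit an explicit 2-rainbow dominating function f and
-- an explicit Roman dominating function g on the spider and show
-- 3·(w(f) + w(g)) ≤ 4·n; minimality of γ_{r2} and γ_R then gives the claim.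
-- Both functions are built leg by leg from periodic patterns along the leg
-- (positions t = 0, 1, … counted from the centre):
--   * f uses ∅,{1},∅,{2} (period 4), the end vertex of a leg is made
--     non-empty, and the centre gets {2} when no leg has length 1 and
--     {1,2} otherwise (then length-1 legs may stay empty);
--   * g uses 0,0,2 (period 3), the end vertex gets t mod 3, the centre 2.
-- The file first develops generic facts: sums, spider labellings assembled
-- from leg labellings (domination is then checked one leg at a time, via
-- the notion LegNeighbour), and labellings of a leg with a special end
-- vertex.  Then the two patterns are shown to dominate, and the combined
-- cost of a leg of length L ≥ 2 is shown to satisfy 3·cost + 2·[L good] ≤ 4·L
-- (six more positions add 3 + 4 to the cost, so induction with period 6;
-- length-1 legs are handled separately).  Summing over the legs, the three
-- good legs pay for the centre, which yields the theorem.

open import Defs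
open import Data.Nat using (ℕ; zero; suc; _+_; _*_; _≤_; _<_; _%_; _≟_; _≡ᵇ_; z≤n; s≤s)
open import Data.Nat.Properties
open import Data.Nat.DivMod using ([m+n]%n≡m%n)
open import Data.Nat.Tactic.RingSolver using (solve-∀)
open import Data.Fin using (Fin; zero; suc; toℕ; fromℕ<)
open import Data.Fin.Properties using (toℕ<n; toℕ-fromℕ<)
open import Data.Bool using (Bool; true; false; not; if_then_else_)
open import Data.Product using (Σ; _×_; _,_)
open import Data.Sum using (_⊎_; inj₁; inj₂)
open import Data.Unit using (tt)
open import Data.Empty using (⊥-elim)
open import Relation.Binary.PropositionalEquality
open import Relation.Nullary using (¬_; yes; no)

-- Σ_{t<n} h t, peeling off the last term: this is how a leg splits into
-- its inner positions and its end vertex.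
sumBelow : ℕ → (ℕ → ℕ) → ℕ
sumBelow zero    h = 0
sumBelow (suc n) h = sumBelow n h + h n

sumBelow-cong : ∀ n (h h′ : ℕ → ℕ) → (∀ t → t < n → h t ≡ h′ t) →
                sumBelow n h ≡ sumBelow n h′
sumBelow-cong zero    h h′ eq = refl
sumBelow-cong (suc n) h h′ eq =
  cong₂ _+_ (sumBelow-cong n h h′ (λ t t<n → eq t (m<n⇒m<1+n t<n))) (eq n (n<1+n n))

sumBelow-unshift : ∀ n h → sumBelow (suc n) h ≡ h 0 + sumBelow n (λ t → h (suc t))
sumBelow-unshift zero    h = +-comm 0 (h 0)
sumBelow-unshift (suc n) h =
  trans (cong (_+ h (suc n)) (sumBelow-unshift n h)) (+-assoc (h 0) _ _)

sumFin-toℕ : ∀ n h → sumFin n (λ j → h (toℕ j)) ≡ sumBelow n h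
sumFin-toℕ zero    h = refl
sumFin-toℕ (suc n) h =
  trans (cong (h 0 +_) (sumFin-toℕ n (λ t → h (suc t)))) (sym (sumBelow-unshift n h))

sumFin-cong : ∀ n (f g : Fin n → ℕ) → (∀ i → f i ≡ g i) → sumFin n f ≡ sumFin n g
sumFin-cong zero    f g eq = refl
sumFin-cong (suc n) f g eq = cong₂ _+_ (eq zero) (sumFin-cong n _ _ (λ i → eq (suc i)))

sumFin-+ : ∀ n (f g : Fin n → ℕ) → sumFin n (λ i → f i + g i) ≡ sumFin n f + sumFin n g
sumFin-+ zero    f g = refl
sumFin-+ (suc n) f g =
  trans (cong (f zero + g zero +_) (sumFin-+ n _ _)) (interchange (f zero) (g zero) _ _)
  where
  interchange : ∀ a b c d → a + b + (c + d) ≡ a + c + (b + d)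
  interchange = solve-∀

sumFin-* : ∀ c n (f : Fin n → ℕ) → sumFin n (λ i → c * f i) ≡ c * sumFin n f
sumFin-* c zero    f = sym (*-zeroʳ c)
sumFin-* c (suc n) f =
  trans (cong (c * f zero +_) (sumFin-* c n _)) (sym (*-distribˡ-+ c (f zero) _))

sumFin-mono : ∀ n (f g : Fin n → ℕ) → (∀ i → f i ≤ g i) → sumFin n f ≤ sumFin n g
sumFin-mono zero    f g le = ≤-refl
sumFin-mono (suc n) f g le = +-mono-≤ (le zero) (sumFin-mono n _ _ (λ i → le (suc i)))

data LegNeighbour {A : Set} (P : A → Set) (c : A) (h : ℕ → A) (L t : ℕ) : Set where
  viaCentre : t ≡ 0 → P c → LegNeighbour P c h L t
  viaPrev   : ∀ {s} → t ≡ suc s → P (h s) → LegNeighbour P c h L t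
  viaNext   : suc t < L → P (h (suc t)) → LegNeighbour P c h L t

LegNeighbour-map : ∀ {A} {P : A → Set} {c h h′ L t} → (∀ s → P (h s) → P (h′ s)) →
                   LegNeighbour P c h L t → LegNeighbour P c h′ L t
LegNeighbour-map ext (viaCentre t≡0 p) = viaCentre t≡0 p
LegNeighbour-map ext (viaPrev t≡1+s p) = viaPrev t≡1+s (ext _ p)
LegNeighbour-map ext (viaNext lt p)    = viaNext lt (ext _ p)

data Colour : Set where
  c₁ c₂ : Colour

Has : Colour → Sub12 → Set
Has c₁ s = has1 s ≡ true
Has c₂ s = has2 s ≡ true

IsTwo : Fin 3 → Set
IsTwo x = toℕ x ≡ 2

module _ {k : ℕ} {ℓ : Fin k → ℕ} where

  spiderFun : {A : Set} → A → (ℕ → ℕ → A) → SpiderV k ℓ → A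
  spiderFun c lab center    = c
  spiderFun c lab (leg i j) = lab (ℓ i) (toℕ j)

  sumV-spiderFun : ∀ {A} (w : A → ℕ) c lab →
    sumV k ℓ (λ u → w (spiderFun c lab u)) ≡
    w c + sumFin k (λ i → sumBelow (ℓ i) (λ t → w (lab (ℓ i) t)))
  sumV-spiderFun w c lab =
    cong (w c +_) (sumFin-cong k _ _ (λ i → sumFin-toℕ (ℓ i) (λ t → w (lab (ℓ i) t))))

  neighbour : ∀ {A} {P : A → Set} c lab i (j : Fin (ℓ i)) →
              LegNeighbour P c (lab (ℓ i)) (ℓ i) (toℕ j) →
              Σ (SpiderV k ℓ) λ v → Adj (leg i j) v × P (spiderFun c lab v)
  neighbour c lab i j (viaCentre j≡0 p) = center , inj₂ (c-edge i j j≡0) , p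
  neighbour {P = P} c lab i j (viaPrev {s} j≡1+s p) =
    leg i q , inj₂ (l-edge i q j (trans (cong suc q≡s) (sym j≡1+s))) ,
    subst (λ x → P (lab (ℓ i) x)) (sym q≡s) p
    where
    s<ℓ : s < ℓ i
    s<ℓ = <-trans (n<1+n s) (subst (_< ℓ i) j≡1+s (toℕ<n j))
    q = fromℕ< s<ℓ
    q≡s = toℕ-fromℕ< s<ℓ
  neighbour {P = P} c lab i j (viaNext lt p) =
    leg i q , inj₁ (l-edge i j q (sym q≡1+j)) , subst (λ x → P (lab (ℓ i) x)) (sym q≡1+j) p
    where
    q = fromℕ< lt
    q≡1+j = toℕ-fromℕ< lt

  legwise-2RDF : ∀ c lab → ¬ isEmpty c →
    (∀ L t → t < L → isEmpty (lab L t) → ∀ x → LegNeighbour (Has x) c (lab L) L t) →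
    Is2RDF k ℓ (spiderFun c lab)
  legwise-2RDF c lab c≠∅ dom center    c=∅ = ⊥-elim (c≠∅ c=∅)
  legwise-2RDF c lab c≠∅ dom (leg i j) e =
    neighbour c lab i j (dom′ c₁) , neighbour c lab i j (dom′ c₂)
    where dom′ = dom (ℓ i) (toℕ j) (toℕ<n j) e

  legwise-RDF : ∀ c lab → toℕ c ≢ 0 →
    (∀ L t → t < L → toℕ (lab L t) ≡ 0 → LegNeighbour IsTwo c (lab L) L t) →
    IsRDF k ℓ (spiderFun c lab)
  legwise-RDF c lab c≠0 dom center    c≡0 = ⊥-elim (c≠0 c≡0)
  legwise-RDF c lab c≠0 dom (leg i j) z   = neighbour c lab i j (dom (ℓ i) (toℕ j) (toℕ<n j) z)

onLeg : {A : Set} → (ℕ → A) → (ℕ → A) → ℕ → ℕ → A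
onLeg inner end L t with suc t ≟ L
... | yes _ = end t
... | no  _ = inner t

onLeg-end : ∀ {A} (inner end : ℕ → A) t → onLeg inner end (suc t) t ≡ end t
onLeg-end inner end t with suc t ≟ suc t
... | yes _  = refl
... | no  ne = ⊥-elim (ne refl)

onLeg-inner : ∀ {A} (inner end : ℕ → A) {L} t → suc t < L → onLeg inner end L t ≡ inner t
onLeg-inner inner end {L} t lt with suc t ≟ L
... | yes eq = ⊥-elim (<-irrefl eq lt)
... | no  _  = refl

onLeg-elim : ∀ {A} (P : A → Set) inner end L t → P (inner t) → P (end t) → P (onLeg inner end L t)
onLeg-elim P inner end L t p q with suc t ≟ L
... | yes _ = q
... | no  _ = p

data Position {A : Set} (inner end : ℕ → A) : ℕ → ℕ → Set where
  atEnd   : ∀ {t} → onLeg inner end (suc t) t ≡ end t → Position inner end (suc t) t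
  atInner : ∀ {L t} → suc t < L → onLeg inner end L t ≡ inner t → Position inner end L t

position : ∀ {A} (inner end : ℕ → A) L t → t < L → Position inner end L t
position inner end L t t<L with m≤n⇒m<n∨m≡n t<L
... | inj₁ lt   = atInner lt (onLeg-inner inner end t lt)
... | inj₂ refl = atEnd (onLeg-end inner end t)

onLeg-sum : ∀ {A} (w : A → ℕ) inner end m →
  sumBelow (suc m) (λ t → w (onLeg inner end (suc m) t)) ≡
  sumBelow m (λ t → w (inner t)) + w (end m)
onLeg-sum w inner end m =
  cong₂ _+_ (sumBelow-cong m _ _ (λ t t<m → cong w (onLeg-inner inner end t (s≤s t<m))))
            (cong w (onLeg-end inner end m))

none only1 only2 both : Sub12
none  = false , false
only1 = true  , false
only2 = false , true
both  = true  , true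

rainbow : ℕ → Sub12
rainbow 0 = none
rainbow 1 = only1
rainbow 2 = none
rainbow 3 = only2
rainbow (suc (suc (suc (suc t)))) = rainbow t

fill : Sub12 → Sub12
fill (false , false) = only1
fill s               = s

fill-⊇ : ∀ x s → Has x s → Has x (fill s)
fill-⊇ c₁ (true  , _)     p = refl
fill-⊇ c₂ (false , true)  p = refl
fill-⊇ c₂ (true  , true)  p = refl

fill-nonempty : ∀ s → ¬ isEmpty (fill s)
fill-nonempty (false , false) (() , _)
fill-nonempty (false , true)  (_ , ())
fill-nonempty (true  , _)     (() , _)

-- The flag b says whether the centre is {2} (b = true) or {1,2}; in the
-- first case a length-1 leg needs the label {1}, in the second ∅ suffices.
centre2 : Bool → Sub12
centre2 true  = only2
centre2 false = both

rainbowEnd : Bool → ℕ → Sub12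
rainbowEnd b     (suc t) = fill (rainbow (suc t))
rainbowEnd true  zero    = only1
rainbowEnd false zero    = none

label2 : Bool → ℕ → ℕ → Sub12
label2 b = onLeg rainbow (rainbowEnd b)

rainbow-gap : ∀ s → isEmpty (rainbow (suc s)) →
              ∀ x → Has x (rainbow s) ⊎ Has x (rainbow (suc (suc s)))
rainbow-gap 0 (() , _)
rainbow-gap 1 e c₁ = inj₁ refl
rainbow-gap 1 e c₂ = inj₂ refl
rainbow-gap 2 (_ , ())
rainbow-gap 3 e c₁ = inj₂ refl
rainbow-gap 3 e c₂ = inj₁ refl
rainbow-gap (suc (suc (suc (suc s)))) e x = rainbow-gap s e x

label2-⊇ : ∀ b L x t → Has x (rainbow t) → Has x (label2 b L t)
label2-⊇ b L x t p = onLeg-elim (Has x) rainbow (rainbowEnd b) L t p (end-⊇ x t p)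
  where
  end-⊇ : ∀ x t → Has x (rainbow t) → Has x (rainbowEnd b t)
  end-⊇ c₁ zero    ()
  end-⊇ c₂ zero    ()
  end-⊇ x  (suc t) p = fill-⊇ x _ p

rainbow-inner : ∀ b L t → suc t < L → isEmpty (rainbow t) →
                ∀ x → LegNeighbour (Has x) (centre2 b) rainbow L t
rainbow-inner b     L zero    lt e c₁ = viaNext lt refl
rainbow-inner true  L zero    lt e c₂ = viaCentre refl refl
rainbow-inner false L zero    lt e c₂ = viaCentre refl refl
rainbow-inner b     L (suc s) lt e x with rainbow-gap s e x
... | inj₁ p = viaPrev refl p
... | inj₂ p = viaNext lt p

rainbow-end : ∀ b t → isEmpty (rainbowEnd b t) →
              ∀ x → LegNeighbour (Has x) (centre2 b) rainbow (suc t) t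
rainbow-end b     (suc t) e  x  = ⊥-elim (fill-nonempty (rainbow (suc t)) e)
rainbow-end true  zero    () x
rainbow-end false zero    e  c₁ = viaCentre refl refl
rainbow-end false zero    e  c₂ = viaCentre refl refl

label2-dominates : ∀ b L t → t < L → isEmpty (label2 b L t) →
                   ∀ x → LegNeighbour (Has x) (centre2 b) (label2 b L) L t
label2-dominates b L t t<L e x with position rainbow (rainbowEnd b) L t t<L
... | atEnd eq =
  LegNeighbour-map (label2-⊇ b L x) (rainbow-end b t (subst isEmpty eq e) x)
... | atInner lt eq =
  LegNeighbour-map (label2-⊇ b L x) (rainbow-inner b L t lt (subst isEmpty eq e) x)

rainbowFun : ∀ {k ℓ} → Bool → SpiderV k ℓ → Sub12
rainbowFun b = spiderFun (centre2 b) (label2 b)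

rainbowFun-2RDF : ∀ {k ℓ} b → Is2RDF k ℓ (rainbowFun b)
rainbowFun-2RDF b = legwise-2RDF (centre2 b) (label2 b) (centre-nonempty b) (label2-dominates b)
  where
  centre-nonempty : ∀ b → ¬ isEmpty (centre2 b)
  centre-nonempty true  (_ , ())
  centre-nonempty false (() , _)

roman : ℕ → Fin 3
roman 0 = zero
roman 1 = zero
roman 2 = suc (suc zero)
roman (suc (suc (suc t))) = roman t

romanEnd : ℕ → Fin 3
romanEnd 0 = zero
romanEnd 1 = suc zero
romanEnd 2 = suc (suc zero)
romanEnd (suc (suc (suc t))) = romanEnd t

labelR : ℕ → ℕ → Fin 3
labelR = onLeg roman romanEnd

roman-gap : ∀ s → toℕ (roman (suc s)) ≡ 0 → IsTwo (roman s) ⊎ IsTwo (roman (suc (suc s)))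
roman-gap 0 z = inj₂ refl
roman-gap 1 ()
roman-gap 2 z = inj₁ refl
roman-gap (suc (suc (suc s))) z = roman-gap s z

romanEnd-gap : ∀ s → toℕ (romanEnd (suc s)) ≡ 0 → IsTwo (roman s)
romanEnd-gap 0 ()
romanEnd-gap 1 ()
romanEnd-gap 2 z = refl
romanEnd-gap (suc (suc (suc s))) z = romanEnd-gap s z

labelR-⊇ : ∀ L t → IsTwo (roman t) → IsTwo (labelR L t)
labelR-⊇ L t p = onLeg-elim IsTwo roman romanEnd L t p (end-⊇ t p)
  where
  end-⊇ : ∀ t → IsTwo (roman t) → IsTwo (romanEnd t)
  end-⊇ 0 ()
  end-⊇ 1 ()
  end-⊇ 2 p = refl
  end-⊇ (suc (suc (suc t))) p = end-⊇ t p

roman-inner : ∀ L t → suc t < L → toℕ (roman t) ≡ 0 → LegNeighbour IsTwo (suc (suc zero)) roman L t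
roman-inner L zero    lt z = viaCentre refl refl
roman-inner L (suc s) lt z with roman-gap s z
... | inj₁ p = viaPrev refl p
... | inj₂ p = viaNext lt p

roman-end : ∀ t → toℕ (romanEnd t) ≡ 0 → LegNeighbour IsTwo (suc (suc zero)) roman (suc t) t
roman-end zero    z = viaCentre refl refl
roman-end (suc s) z = viaPrev refl (romanEnd-gap s z)

labelR-dominates : ∀ L t → t < L → toℕ (labelR L t) ≡ 0 →
                   LegNeighbour IsTwo (suc (suc zero)) (labelR L) L t
labelR-dominates L t t<L z with position roman romanEnd L t t<L
... | atEnd eq      = LegNeighbour-map (labelR-⊇ L) (roman-end t (trans (cong toℕ (sym eq)) z))
... | atInner lt eq = LegNeighbour-map (labelR-⊇ L) (roman-inner L t lt (trans (cong toℕ (sym eq)) z))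

romanFun : ∀ {k ℓ} → SpiderV k ℓ → Fin 3
romanFun = spiderFun (suc (suc zero)) labelR

romanFun-RDF : ∀ {k ℓ} → IsRDF k ℓ romanFun
romanFun-RDF = legwise-RDF (suc (suc zero)) labelR (λ ()) labelR-dominates

centreCost : Bool → ℕ
centreCost b = card (centre2 b) + 2

legCost : Bool → ℕ → ℕ
legCost b L = sumBelow L (λ t → card (label2 b L t)) + sumBelow L (λ t → toℕ (labelR L t))

weight-sum : ∀ k ℓ b → weight2R k ℓ (rainbowFun b) + weightR k ℓ romanFun ≡
                       centreCost b + sumFin k (λ i → legCost b (ℓ i))
weight-sum k ℓ b = begin
    weight2R k ℓ (rainbowFun b) + weightR k ℓ romanFun
  ≡⟨ cong₂ _+_ (sumV-spiderFun {k} {ℓ} card (centre2 b) (label2 b))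
               (sumV-spiderFun {k} {ℓ} toℕ (suc (suc zero)) labelR) ⟩
    (card (centre2 b) + Σ2) + (2 + ΣR)
  ≡⟨ interchange (card (centre2 b)) Σ2 2 ΣR ⟩
    centreCost b + (Σ2 + ΣR)
  ≡⟨ cong (centreCost b +_) (sym (sumFin-+ k _ _)) ⟩
    centreCost b + sumFin k (λ i → legCost b (ℓ i)) ∎
  where
  open ≡-Reasoning
  Σ2 = sumFin k (λ i → sumBelow (ℓ i) (λ t → card (label2 b (ℓ i) t)))
  ΣR = sumFin k (λ i → sumBelow (ℓ i) (λ t → toℕ (labelR (ℓ i) t)))
  interchange : ∀ a b c d → a + b + (c + d) ≡ a + c + (b + d)
  interchange = solve-∀

rainbowCount romanCount : ℕ → ℕ
rainbowCount m = sumBelow m (λ t → card (rainbow t))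
romanCount   m = sumBelow m (λ t → toℕ (roman t))

rainbow-pair : ∀ t → card (rainbow t) + card (rainbow (suc t)) ≡ 1
rainbow-pair 0 = refl
rainbow-pair 1 = refl
rainbow-pair 2 = refl
rainbow-pair 3 = refl
rainbow-pair (suc (suc (suc (suc t)))) = rainbow-pair t

roman-triple : ∀ t → toℕ (roman t) + toℕ (roman (suc t)) + toℕ (roman (suc (suc t))) ≡ 2
roman-triple 0 = refl
roman-triple 1 = refl
roman-triple 2 = refl
roman-triple (suc (suc (suc t))) = roman-triple t

rainbowCount-step : ∀ m → rainbowCount (2 + m) ≡ rainbowCount m + 1
rainbowCount-step m = trans (+-assoc (rainbowCount m) _ _) (cong (rainbowCount m +_) (rainbow-pair m))

romanCount-step : ∀ m → romanCount (3 + m) ≡ romanCount m + 2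
romanCount-step m = trans (regroup (romanCount m) _ _ _) (cong (romanCount m +_) (roman-triple m))
  where
  regroup : ∀ x a b c → x + a + b + c ≡ x + (a + b + c)
  regroup = solve-∀

card-fill-rainbow : ∀ t → card (fill (rainbow t)) ≡ 1
card-fill-rainbow 0 = refl
card-fill-rainbow 1 = refl
card-fill-rainbow 2 = refl
card-fill-rainbow 3 = refl
card-fill-rainbow (suc (suc (suc (suc t)))) = card-fill-rainbow t

-- Cost of a leg of length m + 1 ≥ 2 apart from the colour of its end vertex.
bodyCost : ℕ → ℕ
bodyCost m = rainbowCount m + romanCount m + toℕ (romanEnd m)

legCost-long : ∀ b m → legCost b (suc (suc m)) ≡ 1 + bodyCost (suc m)
legCost-long b m = begin
    legCost b (suc (suc m))
  ≡⟨ cong₂ _+_ (onLeg-sum card rainbow (rainbowEnd b) (suc m)) (onLeg-sum toℕ roman romanEnd (suc m)) ⟩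
    (rainbowCount (suc m) + card (fill (rainbow (suc m)))) + (romanCount (suc m) + e)
  ≡⟨ cong (λ c → (rainbowCount (suc m) + c) + (romanCount (suc m) + e)) (card-fill-rainbow (suc m)) ⟩
    (rainbowCount (suc m) + 1) + (romanCount (suc m) + e)
  ≡⟨ regroup (rainbowCount (suc m)) (romanCount (suc m)) e ⟩
    1 + bodyCost (suc m) ∎
  where
  open ≡-Reasoning
  e = toℕ (romanEnd (suc m))
  regroup : ∀ x y z → x + 1 + (y + z) ≡ 1 + (x + y + z)
  regroup = solve-∀

bodyCost-step : ∀ m → bodyCost (6 + m) ≡ bodyCost m + 7
bodyCost-step m = begin
    rainbowCount (2 + (2 + (2 + m))) + romanCount (3 + (3 + m)) + e
  ≡⟨ cong₂ (λ x y → x + y + e) rainbow6 roman6 ⟩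
    rainbowCount m + 1 + 1 + 1 + (romanCount m + 2 + 2) + e
  ≡⟨ regroup (rainbowCount m) (romanCount m) e ⟩
    bodyCost m + 7 ∎
  where
  open ≡-Reasoning
  e = toℕ (romanEnd m)
  rainbow6 : rainbowCount (2 + (2 + (2 + m))) ≡ rainbowCount m + 1 + 1 + 1
  rainbow6 = trans (rainbowCount-step (4 + m))
               (cong (_+ 1) (trans (rainbowCount-step (2 + m)) (cong (_+ 1) (rainbowCount-step m))))
  roman6 : romanCount (3 + (3 + m)) ≡ romanCount m + 2 + 2
  roman6 = trans (romanCount-step (3 + m)) (cong (_+ 2) (romanCount-step m))
  regroup : ∀ x y z → x + 1 + 1 + 1 + (y + 2 + 2) + z ≡ x + y + z + 7
  regroup = solve-∀

good : ℕ → ℕ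
good L = if isGood L then 1 else 0

isGood-mod : ∀ m → isGood m ≡ not (m % 3 ≡ᵇ 0)
isGood-mod m with m % 3
... | zero  = refl
... | suc _ = refl

good-period : ∀ L → good (3 + L) ≡ good L
good-period L = cong (λ g → if g then 1 else 0) (begin
    isGood (3 + L)            ≡⟨ isGood-mod (3 + L) ⟩
    not ((3 + L) % 3 ≡ᵇ 0)    ≡⟨ cong (λ r → not (r ≡ᵇ 0)) (trans (cong (_% 3) (+-comm 3 L)) ([m+n]%n≡m%n L 3)) ⟩
    not (L % 3 ≡ᵇ 0)          ≡⟨ sym (isGood-mod L) ⟩
    isGood L                  ∎)
  where open ≡-Reasoning

bodyBound-step : ∀ n → 3 * (1 + bodyCost n) + 2 * good (suc n) ≤ 4 * suc n →
                 3 * (1 + bodyCost (6 + n)) + 2 * good (7 + n) ≤ 4 * (7 + n)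
bodyBound-step n ih = begin
    3 * (1 + bodyCost (6 + n)) + 2 * good (7 + n)
  ≡⟨ cong₂ (λ c g → 3 * (1 + c) + 2 * g) (bodyCost-step n)
           (trans (good-period (4 + n)) (good-period (suc n))) ⟩
    3 * (1 + (bodyCost n + 7)) + 2 * good (suc n)
  ≡⟨ shift (bodyCost n) (good (suc n)) ⟩
    3 * (1 + bodyCost n) + 2 * good (suc n) + 21
  ≤⟨ +-monoˡ-≤ 21 ih ⟩
    4 * suc n + 21
  ≤⟨ +-monoʳ-≤ (4 * suc n) (≤ᵇ⇒≤ 21 24 tt) ⟩
    4 * suc n + 24
  ≡⟨ period n ⟩
    4 * (7 + n) ∎
  where
  open ≤-Reasoning
  shift : ∀ c g → 3 * (1 + (c + 7)) + 2 * g ≡ 3 * (1 + c) + 2 * g + 21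
  shift = solve-∀
  period : ∀ n → 4 * suc n + 24 ≡ 4 * (7 + n)
  period = solve-∀

bodyBound : ∀ m → 1 ≤ m → 3 * (1 + bodyCost m) + 2 * good (suc m) ≤ 4 * suc m
bodyBound 1 _ = ≤ᵇ⇒≤ _ _ tt
bodyBound 2 _ = ≤ᵇ⇒≤ _ _ tt
bodyBound 3 _ = ≤ᵇ⇒≤ _ _ tt
bodyBound 4 _ = ≤ᵇ⇒≤ _ _ tt
bodyBound 5 _ = ≤ᵇ⇒≤ _ _ tt
bodyBound 6 _ = ≤ᵇ⇒≤ _ _ tt
bodyBound (suc (suc (suc (suc (suc (suc (suc n))))))) _ =
  bodyBound-step (suc n) (bodyBound (suc n) (s≤s z≤n))

lengthOne : ℕ → ℕ
lengthOne 1 = 1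
lengthOne _ = 0

-- With centre {2} each length-1 leg costs 3 more than its share.
surcharge : Bool → ℕ
surcharge true  = 3
surcharge false = 0

-- The per-leg inequality: good legs and length-1 legs leave some slack,
-- except that length-1 legs cost extra when the centre is {2}.
legBound : ∀ b L → 1 ≤ L →
           3 * legCost b L + 2 * good L + 2 * lengthOne L ≤ 4 * L + surcharge b * lengthOne L
legBound true  1 _ = ≤ᵇ⇒≤ _ _ tt
legBound false 1 _ = ≤ᵇ⇒≤ _ _ tt
legBound b (suc (suc m)) _ = begin
    3 * legCost b (2 + m) + 2 * good (2 + m) + 0
  ≡⟨ +-identityʳ _ ⟩
    3 * legCost b (2 + m) + 2 * good (2 + m)
  ≡⟨ cong (λ c → 3 * c + 2 * good (2 + m)) (legCost-long b m) ⟩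
    3 * (1 + bodyCost (suc m)) + 2 * good (2 + m)
  ≤⟨ bodyBound (suc m) (s≤s z≤n) ⟩
    4 * (2 + m)
  ≡⟨ sym (trans (cong (4 * (2 + m) +_) (*-zeroʳ (surcharge b))) (+-identityʳ _)) ⟩
    4 * (2 + m) + surcharge b * 0 ∎
  where open ≤-Reasoning

sumFin-linear : ∀ n a b (f g : Fin n → ℕ) →
                sumFin n (λ i → a * f i + b * g i) ≡ a * sumFin n f + b * sumFin n g
sumFin-linear n a b f g = trans (sumFin-+ n _ _) (cong₂ _+_ (sumFin-* a n f) (sumFin-* b n g))

legsBound : ∀ k (ℓ : Fin k → ℕ) b → (∀ i → 1 ≤ ℓ i) →
  3 * sumFin k (λ i → legCost b (ℓ i)) + 2 * sumFin k (λ i → good (ℓ i)) + 2 * sumFin k (λ i → lengthOne (ℓ i))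
  ≤ 4 * sumFin k ℓ + surcharge b * sumFin k (λ i → lengthOne (ℓ i))
legsBound k ℓ b legs≥1 = begin
    3 * sumFin k cost + 2 * sumFin k gd + 2 * sumFin k one
  ≡⟨ sym (cong₂ _+_ (sumFin-linear k 3 2 cost gd) (sumFin-* 2 k one)) ⟩
    sumFin k (λ i → 3 * cost i + 2 * gd i) + sumFin k (λ i → 2 * one i)
  ≡⟨ sym (sumFin-+ k _ _) ⟩
    sumFin k (λ i → 3 * cost i + 2 * gd i + 2 * one i)
  ≤⟨ sumFin-mono k _ _ (λ i → legBound b (ℓ i) (legs≥1 i)) ⟩
    sumFin k (λ i → 4 * ℓ i + surcharge b * one i)
  ≡⟨ sumFin-linear k 4 (surcharge b) ℓ one ⟩
    4 * sumFin k ℓ + surcharge b * sumFin k one ∎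
  where
  open ≤-Reasoning
  cost gd one : Fin k → ℕ
  cost i = legCost b (ℓ i)
  gd   i = good (ℓ i)
  one  i = lengthOne (ℓ i)

centreChoice : ℕ → Bool
centreChoice zero    = true
centreChoice (suc _) = false

centreBound : ∀ P → 3 * centreCost (centreChoice P) + surcharge (centreChoice P) * P ≤ 10 + 2 * P
centreBound zero    = ≤ᵇ⇒≤ _ _ tt
centreBound (suc p) = +-monoʳ-≤ 10 (*-monoʳ-≤ 2 (s≤s z≤n))

-- Adding the leg and centre bounds; three good legs pay for the centre.
combine : ∀ {c S G P L B} → 3 * S + 2 * G + 2 * P ≤ 4 * L + B * P →
          3 * c + B * P ≤ 10 + 2 * P → 3 ≤ G → 3 * (c + S) ≤ 4 * (1 + L)
combine {c} {S} {G} {P} {L} {B} legs centre G≥3 = +-cancelʳ-≤ slack _ _ (begin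
    3 * (c + S) + slack
  ≡⟨ split c S G P B ⟩
    (3 * S + 2 * G + 2 * P) + (3 * c + B * P)
  ≤⟨ +-mono-≤ legs (≤-trans centre (+-monoˡ-≤ (2 * P) (+-monoʳ-≤ 4 (*-monoʳ-≤ 2 G≥3)))) ⟩
    (4 * L + B * P) + (4 + 2 * G + 2 * P)
  ≡⟨ join L G P B ⟩
    4 * (1 + L) + slack ∎)
  where
  open ≤-Reasoning
  slack = 2 * G + 2 * P + B * P
  split : ∀ c S G P B → 3 * (c + S) + (2 * G + 2 * P + B * P) ≡ (3 * S + 2 * G + 2 * P) + (3 * c + B * P)
  split = solve-∀
  join : ∀ L G P B → (4 * L + B * P) + (4 + 2 * G + 2 * P) ≡ 4 * (1 + L) + (2 * G + 2 * P + B * P)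
  join = solve-∀

lemma7 : (k : ℕ) (ℓ : Fin k → ℕ) →
         3 ≤ k → (∀ i → 1 ≤ ℓ i) →
         3 ≤ countFin k (λ i → isGood (ℓ i)) →
         (a b : ℕ) → IsGammaR2 k ℓ a → IsGammaR k ℓ b →
         3 * (a + b) ≤ 4 * order k ℓ
lemma7 k ℓ _ legs≥1 good≥3 a b (_ , a-minimal) (_ , b-minimal) = begin
    3 * (a + b)
  ≤⟨ *-monoʳ-≤ 3 (+-mono-≤ (a-minimal (rainbowFun β) (rainbowFun-2RDF β))
                           (b-minimal romanFun romanFun-RDF)) ⟩
    3 * (weight2R k ℓ (rainbowFun β) + weightR k ℓ romanFun)
  ≡⟨ cong (3 *_) (weight-sum k ℓ β) ⟩
    3 * (centreCost β + legCosts)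
  ≤⟨ combine {centreCost β} {legCosts} {goodLegs} {P} {sumFin k ℓ} {surcharge β}
             (legsBound k ℓ β legs≥1) (centreBound P) good≥3 ⟩
    4 * order k ℓ ∎
  where
  open ≤-Reasoning
  P = sumFin k (λ i → lengthOne (ℓ i))
  β = centreChoice P
  legCosts = sumFin k (λ i → legCost β (ℓ i))
  goodLegs = sumFin k (λ i → good (ℓ i))
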